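{- Let $n \ge k \ge 1$ and $d \ge 2$. Then \[g(n,d,k) \le f(n-k,d) + \sum_{i=1}^k \binom{k}{i} f(n-k,d-1,i),\] where the functions $f(\cdot,\cdot)$, $f(\cdot,\cdot,\cdot)$ and $g(\cdot,\cdot,\cdot)$ are as defined in the context.
   Context: For $d \ge 1$, a $d$-simplex is a collection of $d+1$ sets $A_1,\ldots,A_{d+1}$ such that $\bigcap_{i=1}^{d+1} A_i = \emptyset$ but $\bigcap_{i \ne j} A_i \ne \emptyset$ for every $1 \le j \le d+1$; a family of sets is $d$-simplex-free if no $d+1$ of its members form a $d$-simplex. For an $m$-element set $X$ and integer $i \ge 0$, $X^{(\le i)}$ denotes the family of subsets of $X$ of size at most $i$. For positive integers $m,d$, $f(m,d)$ is the maximum size of a $d$-simplex-free family of subsets of an $m$-element set. For $d \ge 1$ and integers $m \ge k \ge 0$, $f(m,d,k)$ is the maximum size of a $d$-simplex-free family $\mathcal{F} \subseteq X^{(\le m-k)}$ where $|X| = m$, and $g(m,d,k)$ is the maximum size of such a $d$-simplex-free family $\mathcal{F} \subseteq X^{(\le m-k)}$ that in addition contains at least one set of size exactly $m-k$. -}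

module Defs where

open import Data.Nat using (ℕ; suc; _+_; _*_; _≤_)
open import Data.Nat.Combinatorics using (_C_)
open import Data.Fin using (Fin; punchIn)
open import Data.Fin.Subset using (Subset; ⋂; ∣_∣; Empty; Nonempty)
open import Data.List using (List; length; tabulate; map; upTo)
open import Data.Nat.ListAction using (sum)
open import Data.List.Relation.Unary.All using (All)
open import Data.List.Relation.Unary.Any using (Any)
open import Data.List.Relation.Unary.Unique.Propositional using (Unique)
open import Data.List.Membership.Propositional using (_∈_)
open import Data.Product using (Σ; _×_)
open import Relation.Nullary using (¬_)
open import Relation.Binary.PropositionalEquality using (_≡_)

-- Ground set X = Fin m; subsets of X are Data.Fin.Subset.
-- A family of subsets is a duplicate-free list (a finite set of subsets);
-- its size is its length.
Family : ℕ → Set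
Family m = List (Subset m)

-- A d-simplex: d+1 sets A_1..A_{d+1} (indexed by Fin (suc d)) whose total
-- intersection is empty while each intersection omitting one index j
-- (the indices punchIn j : Fin d → Fin (suc d), i.e. all i ≠ j) is nonempty.
IsSimplex : ∀ {m} (d : ℕ) → (Fin (suc d) → Subset m) → Set
IsSimplex d A =
  Empty (⋂ (tabulate A)) × (∀ j → Nonempty (⋂ (tabulate (λ i → A (punchIn j i)))))

SimplexFree : ∀ {m} (d : ℕ) → Family m → Set
SimplexFree d F = ∀ A → (∀ i → A i ∈ F) → ¬ IsSimplex d A

-- F ⊆ X^(≤ m-k): every member S has |S| ≤ m - k (as |S| + k ≤ m,
-- so that for k > m only the empty family qualifies).
AtMost : ∀ {m} (k : ℕ) → Family m → Set
AtMost {m} k F = All (λ S → ∣ S ∣ + k ≤ m) F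

HasTop : ∀ {m} (k : ℕ) → Family m → Set
HasTop {m} k F = Any (λ S → ∣ S ∣ + k ≡ m) F

IsMax : ∀ {m} → (Family m → Set) → ℕ → Set
IsMax P N =
  (Σ _ λ F → Unique F × P F × length F ≡ N) ×
  (∀ F → Unique F → P F → length F ≤ N)

IsF : ℕ → ℕ → ℕ → Set
IsF m d N = IsMax {m} (λ F → SimplexFree d F) N

IsFk : ℕ → ℕ → ℕ → ℕ → Set
IsFk m d k N = IsMax {m} (λ F → SimplexFree d F × AtMost k F) N

IsG : ℕ → ℕ → ℕ → ℕ → Set
IsG m d k N = IsMax {m} (λ F → SimplexFree d F × AtMost k F × HasTop k F) N

sum1to : ℕ → (ℕ → ℕ) → ℕ
sum1to k h = sum (map (λ i → h (suc i)) (upTo k))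

module Submission where

-- Let F be a d-simplex-free family on X = Fin n (d ≥ 1) whose
-- members have at most n - k elements, and let T ∈ F have exactly n - k
-- elements, so that its complement C = X ∖ T has k elements.  Sort the
-- members S of F by their trace B = S ∩ C.  Within one fibre the map
-- S ↦ S ∩ T is injective, so the fibre has as many members as the family
-- L_B = { S ∩ T } of subsets of T, a ground set of size n - k.
--   * L_∅ is d-simplex-free, since a simplex in L_∅ is one in F; hence
--     the fibre over ∅ has at most f(n-k,d) members.
--   * If |B| = i ≥ 1, every member of L_B has at most n-k-i elements, and
--     L_B is (d-1)-simplex-free: a (d-1)-simplex in L_B together with T is
--     a d-simplex in F (the points of B witness the face avoiding T).
--     Hence that fibre has at most f(n-k,d-1,i) members.
-- Summing over the C(k,i) subsets B ⊆ C of size i gives the bound.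

open import Defs
open import Data.Nat using (ℕ; zero; suc; _+_; _*_; _∸_; _≤_; z≤n; s≤s)
open import Data.Nat.Combinatorics using (_C_; k>n⇒nCk≡0; nCk+nC[k+1]≡[n+1]C[k+1])
open import Data.Nat.Properties
open import Data.Nat.ListAction using (sum)
open import Algebra.Properties.CommutativeSemigroup +-commutativeSemigroup using (interchange)
open import Data.Fin using (Fin; zero; suc; punchIn)
open import Data.Fin.Subset
  using (Subset; inside; outside; ⋂; ∣_∣; Empty; Nonempty; ∁; _∩_)
  renaming (_∈_ to _∈ₛ_)
open import Data.Fin.Subset.Properties
  using (∈⊤; x∈p∩q⁺; p∩q⊆p; p∩q⊆q; _∈?_; x∉p⇒x∈∁p; ∣p∣≤n; ∣∁p∣≡n∸∣p∣)
import Data.Bool as Bool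
open import Data.Vec using ([]; _∷_; here; there)
open import Data.Vec.Properties using (≡-dec; ∷-injective)
import Data.Vec.Functional as Vector
open import Data.List using (List; []; _∷_; length; tabulate; map; filter; applyUpTo)
open import Data.List.Properties using (length-map; tabulate-cong)
open import Data.List.Membership.Propositional using (_∈_; find)
open import Data.List.Membership.Propositional.Properties using (∈-map⁻; ∈-filter⁻)
import Data.List.Relation.Unary.Any as Any
import Data.List.Relation.Unary.All as All
import Data.List.Relation.Unary.All.Properties as All
open import Data.List.Relation.Unary.Unique.Propositional using (Unique; []; _∷_)
open import Data.List.Relation.Unary.Unique.Propositional.Properties using (filter⁺)
open import Data.Product using (Σ; _×_; _,_; proj₁; proj₂)
open import Relation.Nullary using (¬_; Dec; yes; no; contradiction)
open import Relation.Binary.PropositionalEquality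

sumBelow : ℕ → (ℕ → ℕ) → ℕ
sumBelow zero    g = 0
sumBelow (suc n) g = g 0 + sumBelow n (λ i → g (suc i))

sumBelow-cong : ∀ n {g h : ℕ → ℕ} → (∀ i → g i ≡ h i) → sumBelow n g ≡ sumBelow n h
sumBelow-cong zero    g≡h = refl
sumBelow-cong (suc n) g≡h = cong₂ _+_ (g≡h 0) (sumBelow-cong n (λ i → g≡h (suc i)))

sumBelow-+ : ∀ n (g h : ℕ → ℕ) →
  sumBelow n (λ i → g i + h i) ≡ sumBelow n g + sumBelow n h
sumBelow-+ zero    g h = refl
sumBelow-+ (suc n) g h = trans
  (cong (g 0 + h 0 +_) (sumBelow-+ n (λ i → g (suc i)) (λ i → h (suc i))))
  (interchange (g 0) (h 0) _ _)

sumBelow-last : ∀ n (g : ℕ → ℕ) → sumBelow (suc n) g ≡ sumBelow n g + g n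
sumBelow-last zero    g = +-comm (g 0) 0
sumBelow-last (suc n) g = trans
  (cong (g 0 +_) (sumBelow-last n (λ i → g (suc i))))
  (sym (+-assoc (g 0) _ _))

sum-applyUpTo : ∀ (g f : ℕ → ℕ) n → sum (map g (applyUpTo f n)) ≡ sumBelow n (λ i → g (f i))
sum-applyUpTo g f zero    = refl
sum-applyUpTo g f (suc n) = cong (g (f 0) +_) (sum-applyUpTo g (λ i → f (suc i)) n)

binomialSum : ℕ → (ℕ → ℕ) → ℕ
binomialSum k h = sumBelow (suc k) (λ i → (k C i) * h i)

-- Pascal's rule for the binomial sum: a subset of a (k+1)-set either avoids
-- the first point (weight h) or contains it (size shifted by one).
binomialSum-pascal : ∀ k (h : ℕ → ℕ) →
  binomialSum (suc k) h ≡ binomialSum k h + binomialSum k (λ i → h (suc i))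
binomialSum-pascal k h = begin
    1 * h 0 + sumBelow (suc k) (λ i → (suc k C suc i) * h′ i)
  ≡⟨ cong (1 * h 0 +_) (sumBelow-cong (suc k) pascal) ⟩
    1 * h 0 + sumBelow (suc k) (λ i → (k C suc i) * h′ i + (k C i) * h′ i)
  ≡⟨ cong (1 * h 0 +_) (sumBelow-+ (suc k) (λ i → (k C suc i) * h′ i) (λ i → (k C i) * h′ i)) ⟩
    1 * h 0 + (sumBelow (suc k) (λ i → (k C suc i) * h′ i) + binomialSum k h′)
  ≡⟨ sym (+-assoc (1 * h 0) _ _) ⟩
    1 * h 0 + sumBelow (suc k) (λ i → (k C suc i) * h′ i) + binomialSum k h′
  ≡⟨ cong (λ s → 1 * h 0 + s + binomialSum k h′) topVanishes ⟩
    binomialSum k h + binomialSum k h′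
  ∎
  where
  open ≡-Reasoning
  h′ : ℕ → ℕ
  h′ i = h (suc i)
  pascal : ∀ i → (suc k C suc i) * h′ i ≡ (k C suc i) * h′ i + (k C i) * h′ i
  pascal i = begin
      (suc k C suc i) * h′ i
    ≡⟨ cong (_* h′ i) (sym (nCk+nC[k+1]≡[n+1]C[k+1] k i)) ⟩
      ((k C i) + (k C suc i)) * h′ i
    ≡⟨ cong (_* h′ i) (+-comm (k C i) (k C suc i)) ⟩
      ((k C suc i) + (k C i)) * h′ i
    ≡⟨ *-distribʳ-+ (h′ i) (k C suc i) (k C i) ⟩
      (k C suc i) * h′ i + (k C i) * h′ i
    ∎
  topVanishes : sumBelow (suc k) (λ i → (k C suc i) * h′ i) ≡ sumBelow k (λ i → (k C suc i) * h′ i)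
  topVanishes = begin
      sumBelow (suc k) (λ i → (k C suc i) * h′ i)
    ≡⟨ sumBelow-last k _ ⟩
      sumBelow k (λ i → (k C suc i) * h′ i) + (k C suc k) * h′ k
    ≡⟨ cong (λ c → sumBelow k (λ i → (k C suc i) * h′ i) + c * h′ k) (k>n⇒nCk≡0 (n<1+n k)) ⟩
      sumBelow k (λ i → (k C suc i) * h′ i) + 0
    ≡⟨ +-identityʳ _ ⟩
      sumBelow k (λ i → (k C suc i) * h′ i)
    ∎

sumSubsets : ∀ m → (Subset m → ℕ) → ℕ
sumSubsets zero    G = G []
sumSubsets (suc m) G = sumSubsets m (λ B → G (outside ∷ B)) + sumSubsets m (λ B → G (inside ∷ B))

sumSubsets-cong : ∀ m {G H : Subset m → ℕ} → (∀ B → G B ≡ H B) → sumSubsets m G ≡ sumSubsets m H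
sumSubsets-cong zero    G≡H = G≡H []
sumSubsets-cong (suc m) G≡H =
  cong₂ _+_ (sumSubsets-cong m (λ B → G≡H (outside ∷ B))) (sumSubsets-cong m (λ B → G≡H (inside ∷ B)))

sumSubsets-+ : ∀ m (G H : Subset m → ℕ) →
  sumSubsets m (λ B → G B + H B) ≡ sumSubsets m G + sumSubsets m H
sumSubsets-+ zero    G H = refl
sumSubsets-+ (suc m) G H = trans
  (cong₂ _+_ (sumSubsets-+ m G₀ H₀) (sumSubsets-+ m G₁ H₁))
  (interchange (sumSubsets m G₀) (sumSubsets m H₀) (sumSubsets m G₁) (sumSubsets m H₁))
  where
  G₀ G₁ H₀ H₁ : Subset m → ℕ
  G₀ B = G (outside ∷ B)
  G₁ B = G (inside ∷ B)
  H₀ B = H (outside ∷ B)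
  H₁ B = H (inside ∷ B)

sumSubsets-zero : ∀ m (G : Subset m → ℕ) → (∀ B → G B ≡ 0) → sumSubsets m G ≡ 0
sumSubsets-zero zero    G G≡0 = G≡0 []
sumSubsets-zero (suc m) G G≡0 =
  cong₂ _+_ (sumSubsets-zero m _ (λ B → G≡0 (outside ∷ B))) (sumSubsets-zero m _ (λ B → G≡0 (inside ∷ B)))

sumSubsets-point : ∀ m (G : Subset m → ℕ) (v : Subset m) →
  G v ≡ 1 → (∀ B → B ≢ v → G B ≡ 0) → sumSubsets m G ≡ 1
sumSubsets-point zero G [] Gv≡1 _ = Gv≡1
sumSubsets-point (suc m) G (outside ∷ v) Gv≡1 G≡0 = cong₂ _+_
  (sumSubsets-point m _ v Gv≡1 (λ B B≢v → G≡0 (outside ∷ B) (λ eq → B≢v (proj₂ (∷-injective eq)))))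
  (sumSubsets-zero m _ (λ B → G≡0 (inside ∷ B) (λ ())))
sumSubsets-point (suc m) G (inside ∷ v) Gv≡1 G≡0 = cong₂ _+_
  (sumSubsets-zero m _ (λ B → G≡0 (outside ∷ B) (λ ())))
  (sumSubsets-point m _ v Gv≡1 (λ B B≢v → G≡0 (inside ∷ B) (λ eq → B≢v (proj₂ (∷-injective eq)))))

sumSubsets≤binomialSum : ∀ m (G : Subset m → ℕ) (h : ℕ → ℕ) →
  (∀ B → G B ≤ h ∣ B ∣) → sumSubsets m G ≤ binomialSum m h
sumSubsets≤binomialSum zero G h G≤h =
  ≤-trans (G≤h []) (≤-reflexive (sym (trans (+-identityʳ (1 * h 0)) (*-identityˡ (h 0)))))
sumSubsets≤binomialSum (suc m) G h G≤h =
  subst (sumSubsets (suc m) G ≤_) (sym (binomialSum-pascal m h))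
  (+-mono-≤ (sumSubsets≤binomialSum m _ h (λ B → G≤h (outside ∷ B)))
            (sumSubsets≤binomialSum m _ (λ i → h (suc i)) (λ B → G≤h (inside ∷ B))))

_≟ₛ_ : ∀ {m} (v w : Subset m) → Dec (v ≡ w)
_≟ₛ_ = ≡-dec Bool._≟_

indicator : ∀ {m} → Subset m → Subset m → ℕ
indicator v B with v ≟ₛ B
... | yes _ = 1
... | no  _ = 0

sumSubsets-indicator : ∀ m (v : Subset m) → sumSubsets m (indicator v) ≡ 1
sumSubsets-indicator m v = sumSubsets-point m (indicator v) v self other
  where
  self : indicator v v ≡ 1
  self with v ≟ₛ v
  ... | yes _   = refl
  ... | no  v≢v = contradiction refl v≢v
  other : ∀ B → B ≢ v → indicator v B ≡ 0
  other B B≢v with v ≟ₛ B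
  ... | yes v≡B = contradiction (sym v≡B) B≢v
  ... | no  _   = refl

-- Double counting: a list is the disjoint union of its fibres over all values of a key.
module Fibres {A : Set} {m} (key : A → Subset m) where

  fibre : Subset m → List A → List A
  fibre B = filter (λ x → key x ≟ₛ B)

  length-fibre-∷ : ∀ B x xs → length (fibre B (x ∷ xs)) ≡ indicator (key x) B + length (fibre B xs)
  length-fibre-∷ B x xs with key x ≟ₛ B
  ... | yes _ = refl
  ... | no  _ = refl

  length≡sumFibres : ∀ xs → length xs ≡ sumSubsets m (λ B → length (fibre B xs))
  length≡sumFibres [] = sym (sumSubsets-zero m _ (λ B → refl))
  length≡sumFibres (x ∷ xs) = sym (begin
      sumSubsets m (λ B → length (fibre B (x ∷ xs)))
    ≡⟨ sumSubsets-cong m (λ B → length-fibre-∷ B x xs) ⟩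
      sumSubsets m (λ B → indicator (key x) B + length (fibre B xs))
    ≡⟨ sumSubsets-+ m (indicator (key x)) (λ B → length (fibre B xs)) ⟩
      sumSubsets m (indicator (key x)) + sumSubsets m (λ B → length (fibre B xs))
    ≡⟨ cong₂ _+_ (sumSubsets-indicator m (key x)) (sym (length≡sumFibres xs)) ⟩
      suc (length xs)
    ∎)
    where open ≡-Reasoning

-- restrict M S is the trace S ∩ M, re-indexed as a subset of Fin ∣ M ∣.
restrict : ∀ {n} (M : Subset n) → Subset n → Subset ∣ M ∣
restrict []             []      = []
restrict (inside  ∷ M) (b ∷ S) = b ∷ restrict M S
restrict (outside ∷ M) (b ∷ S) = restrict M S

∈-restrict⁺ : ∀ {n} (M : Subset n) (x : Fin n) → x ∈ₛ M →
  Σ (Fin ∣ M ∣) λ y → ∀ S → x ∈ₛ S → y ∈ₛ restrict M S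
∈-restrict⁺ (inside ∷ M) zero here = zero , λ { (_ ∷ S) here → here }
∈-restrict⁺ (inside ∷ M) (suc x) (there x∈M) with ∈-restrict⁺ M x x∈M
... | y , y∈ = suc y , λ { (_ ∷ S) (there x∈S) → there (y∈ S x∈S) }
∈-restrict⁺ (outside ∷ M) (suc x) (there x∈M) with ∈-restrict⁺ M x x∈M
... | y , y∈ = y , λ { (_ ∷ S) (there x∈S) → y∈ S x∈S }

∈-restrict⁻ : ∀ {n} (M : Subset n) (y : Fin ∣ M ∣) →
  Σ (Fin n) λ x → x ∈ₛ M × (∀ S → y ∈ₛ restrict M S → x ∈ₛ S)
∈-restrict⁻ (inside ∷ M) zero = zero , here , λ { (_ ∷ S) here → here }
∈-restrict⁻ (inside ∷ M) (suc y) with ∈-restrict⁻ M y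
... | x , x∈M , x∈ = suc x , there x∈M , λ { (_ ∷ S) (there y∈S) → there (x∈ S y∈S) }
∈-restrict⁻ (outside ∷ M) y with ∈-restrict⁻ M y
... | x , x∈M , x∈ = suc x , there x∈M , λ { (_ ∷ S) y∈S → there (x∈ S y∈S) }

restrict-injective : ∀ {n} (M S S′ : Subset n) →
  restrict M S ≡ restrict M S′ → restrict (∁ M) S ≡ restrict (∁ M) S′ → S ≡ S′
restrict-injective [] [] [] _ _ = refl
restrict-injective (inside ∷ M) (b ∷ S) (b′ ∷ S′) eq eq∁ with ∷-injective eq
... | b≡b′ , eqᵗ = cong₂ _∷_ b≡b′ (restrict-injective M S S′ eqᵗ eq∁)
restrict-injective (outside ∷ M) (b ∷ S) (b′ ∷ S′) eq eq∁ with ∷-injective eq∁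
... | b≡b′ , eq∁ᵗ = cong₂ _∷_ b≡b′ (restrict-injective M S S′ eq eq∁ᵗ)

∣restrict∣ : ∀ {n} (M S : Subset n) → ∣ S ∣ ≡ ∣ restrict M S ∣ + ∣ restrict (∁ M) S ∣
∣restrict∣ [] [] = refl
∣restrict∣ (inside  ∷ M) (inside  ∷ S) = cong suc (∣restrict∣ M S)
∣restrict∣ (inside  ∷ M) (outside ∷ S) = ∣restrict∣ M S
∣restrict∣ (outside ∷ M) (inside  ∷ S) = trans (cong suc (∣restrict∣ M S)) (sym (+-suc _ _))
∣restrict∣ (outside ∷ M) (outside ∷ S) = ∣restrict∣ M S

⋂⁺ : ∀ {m n} (A : Fin m → Subset n) x → (∀ i → x ∈ₛ A i) → x ∈ₛ ⋂ (tabulate A)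
⋂⁺ {zero}  A x x∈A = ∈⊤
⋂⁺ {suc m} A x x∈A = x∈p∩q⁺ (x∈A zero , ⋂⁺ (λ i → A (suc i)) x (λ i → x∈A (suc i)))

⋂⁻ : ∀ {m n} (A : Fin m → Subset n) x → x ∈ₛ ⋂ (tabulate A) → ∀ i → x ∈ₛ A i
⋂⁻ {suc m} A x x∈⋂ zero    = p∩q⊆p (A zero) _ x∈⋂
⋂⁻ {suc m} A x x∈⋂ (suc i) = ⋂⁻ (λ i → A (suc i)) x (p∩q⊆q (A zero) _ x∈⋂) i

IsSimplex-cong : ∀ {n} d {A A′ : Fin (suc d) → Subset n} →
  (∀ i → A i ≡ A′ i) → IsSimplex d A → IsSimplex d A′
IsSimplex-cong d A≡A′ (empty , nonempty) =
  subst (λ As → Empty (⋂ As)) (tabulate-cong A≡A′) empty ,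
  λ j → subst (λ As → Nonempty (⋂ As)) (tabulate-cong (λ i → A≡A′ (punchIn j i))) (nonempty j)

⋂-restrict-nonempty : ∀ {m n} (M : Subset n) (A : Fin m → Subset n) →
  Nonempty (⋂ (tabulate (λ i → restrict M (A i)))) → Σ (Fin n) λ x → x ∈ₛ M × x ∈ₛ ⋂ (tabulate A)
⋂-restrict-nonempty M A (y , y∈⋂) with ∈-restrict⁻ M y
... | x , x∈M , x∈ = x , x∈M , ⋂⁺ A x (λ i → x∈ (A i) (⋂⁻ (λ i → restrict M (A i)) y y∈⋂ i))

⋂-restrict-empty : ∀ {m n} (M : Subset n) (A : Fin m → Subset n) →
  Empty (⋂ (tabulate (λ i → restrict M (A i)))) → ∀ x → x ∈ₛ M → ¬ x ∈ₛ ⋂ (tabulate A)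
⋂-restrict-empty M A empty x x∈M x∈⋂ with ∈-restrict⁺ M x x∈M
... | y , y∈ = empty (y , ⋂⁺ (λ i → restrict M (A i)) y (λ i → y∈ (A i) (⋂⁻ A x x∈⋂ i)))

simplex-lift-inside : ∀ {n} d (M : Subset n) (A : Fin (suc d) → Subset n) →
  Empty (restrict (∁ M) (A zero)) →
  IsSimplex d (λ i → restrict M (A i)) → IsSimplex d A
simplex-lift-inside d M A outsideEmpty (empty , nonempty) = ⋂A-empty , faces
  where
  ⋂A-empty : Empty (⋂ (tabulate A))
  ⋂A-empty (x , x∈⋂) with x ∈? M
  ... | yes x∈M = ⋂-restrict-empty M A empty x x∈M x∈⋂
  ... | no  x∉M with ∈-restrict⁺ (∁ M) x (x∉p⇒x∈∁p x∉M)
  ...   | y , y∈ = outsideEmpty (y , y∈ (A zero) (⋂⁻ A x x∈⋂ zero))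
  faces : ∀ j → Nonempty (⋂ (tabulate (λ i → A (punchIn j i))))
  faces j with ⋂-restrict-nonempty M (λ i → A (punchIn j i)) (nonempty j)
  ... | x , _ , x∈⋂ = x , x∈⋂

-- Sets sharing a nonempty trace B outside M: a simplex of their traces on M,
-- together with M itself, is a simplex one dimension higher.  The face
-- opposite M is witnessed by the points of B.
simplex-lift-with : ∀ {n} d (M : Subset n) (A : Fin (suc d) → Subset n) (B : Subset ∣ ∁ M ∣) →
  (∀ i → restrict (∁ M) (A i) ≡ B) → Nonempty B →
  IsSimplex d (λ i → restrict M (A i)) → IsSimplex (suc d) (M Vector.∷ A)
simplex-lift-with d M A B trace≡B (b , b∈B) (empty , nonempty) = ⋂-empty , faces
  where
  ⋂-empty : Empty (M ∩ ⋂ (tabulate A))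
  ⋂-empty (x , x∈) = ⋂-restrict-empty M A empty x (p∩q⊆p M _ x∈) (p∩q⊆q M _ x∈)
  faces : ∀ j → Nonempty (⋂ (tabulate (λ i → (M Vector.∷ A) (punchIn j i))))
  faces zero with ∈-restrict⁻ (∁ M) b
  ... | x , _ , x∈ = x , ⋂⁺ A x (λ i → x∈ (A i) (subst (b ∈ₛ_) (sym (trace≡B i)) b∈B))
  faces (suc j) with ⋂-restrict-nonempty M (λ i → A (punchIn j i)) (nonempty j)
  ... | x , x∈M , x∈⋂ = x , x∈p∩q⁺ (x∈M , x∈⋂)

∣p∣≡0⇒Empty : ∀ {m} (B : Subset m) → ∣ B ∣ ≡ 0 → Empty B
∣p∣≡0⇒Empty (inside  ∷ B) ()
∣p∣≡0⇒Empty (outside ∷ B) ∣B∣≡0 (suc x , there x∈B) = ∣p∣≡0⇒Empty B ∣B∣≡0 (x , x∈B)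

∣p∣≡suc⇒Nonempty : ∀ {m i} (B : Subset m) → ∣ B ∣ ≡ suc i → Nonempty B
∣p∣≡suc⇒Nonempty (inside  ∷ B) _ = zero , here
∣p∣≡suc⇒Nonempty (outside ∷ B) ∣B∣≡suc with ∣p∣≡suc⇒Nonempty B ∣B∣≡suc
... | x , x∈B = suc x , there x∈B

map-unique : ∀ {A B : Set} (f : A → B) xs →
  (∀ {x y} → x ∈ xs → y ∈ xs → f x ≡ f y → x ≡ y) → Unique xs → Unique (map f xs)
map-unique f []       _   []           = []
map-unique f (x ∷ xs) inj (x∉xs ∷ xs!) =
  All.map⁺ (All.tabulate (λ y∈xs fx≡fy → All.lookup x∉xs y∈xs (inj (Any.here refl) (Any.there y∈xs) fx≡fy)))
  ∷ map-unique f xs (λ x∈ y∈ → inj (Any.there x∈) (Any.there y∈)) xs!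

module TraceFibres {n} (T : Subset n) (F : Family n) where

  open Fibres (restrict (∁ T)) using (fibre)

  L : Subset ∣ ∁ T ∣ → Family ∣ T ∣
  L B = map (restrict T) (fibre B F)

  ∈-fibre : ∀ B {S} → S ∈ fibre B F → S ∈ F × restrict (∁ T) S ≡ B
  ∈-fibre B = ∈-filter⁻ (λ S → restrict (∁ T) S ≟ₛ B) {xs = F}

  ∈-L : ∀ B {y} → y ∈ L B → Σ (Subset n) λ S → S ∈ F × restrict (∁ T) S ≡ B × y ≡ restrict T S
  ∈-L B y∈ with ∈-map⁻ (restrict T) y∈
  ... | S , S∈fibre , y≡ with ∈-fibre B S∈fibre
  ...   | S∈F , trace≡B = S , S∈F , trace≡B , y≡

  -- Members of a fibre are determined by their trace on T.
  L-unique : Unique F → ∀ B → Unique (L B)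
  L-unique F! B = map-unique (restrict T) (fibre B F)
    (λ S∈ S′∈ eq → restrict-injective T _ _ eq (trans (proj₂ (∈-fibre B S∈)) (sym (proj₂ (∈-fibre B S′∈)))))
    (filter⁺ (λ S → restrict (∁ T) S ≟ₛ B) F!)

  L-atMost : ∀ k → AtMost k F → ∣ T ∣ + k ≡ n → ∀ B → AtMost ∣ B ∣ (L B)
  L-atMost k small |T|+k≡n B = All.tabulate bound
    where
    bound : ∀ {y} → y ∈ L B → ∣ y ∣ + ∣ B ∣ ≤ ∣ T ∣
    bound y∈ with ∈-L B y∈
    ... | S , S∈F , refl , refl = +-cancelʳ-≤ k _ _ (begin
        ∣ restrict T S ∣ + ∣ restrict (∁ T) S ∣ + k ≡⟨ cong (_+ k) (∣restrict∣ T S) ⟨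
        ∣ S ∣ + k                                 ≤⟨ All.lookup small S∈F ⟩
        n                                         ≡⟨ |T|+k≡n ⟨
        ∣ T ∣ + k                                 ∎)
      where open ≤-Reasoning

  record Preimages {m} (B : Subset ∣ ∁ T ∣) (A′ : Fin m → Subset ∣ T ∣) : Set where
    field
      S       : Fin m → Subset n
      S∈F     : ∀ i → S i ∈ F
      trace≡B : ∀ i → restrict (∁ T) (S i) ≡ B
      A′≡     : ∀ i → A′ i ≡ restrict T (S i)

  preimages : ∀ {m} B (A′ : Fin m → Subset ∣ T ∣) → (∀ i → A′ i ∈ L B) → Preimages B A′
  preimages B A′ A′∈L = record
    { S       = λ i → proj₁ (∈-L B (A′∈L i))
    ; S∈F     = λ i → proj₁ (proj₂ (∈-L B (A′∈L i)))
    ; trace≡B = λ i → proj₁ (proj₂ (proj₂ (∈-L B (A′∈L i))))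
    ; A′≡     = λ i → proj₂ (proj₂ (proj₂ (∈-L B (A′∈L i))))
    }

  L-simplexFree-empty : ∀ d → SimplexFree d F → ∀ B → Empty B → SimplexFree d (L B)
  L-simplexFree-empty d free B B-empty A′ A′∈L simplex =
    free S S∈F (simplex-lift-inside d T S (subst Empty (sym (trace≡B zero)) B-empty)
                 (IsSimplex-cong d A′≡ simplex))
    where open Preimages (preimages B A′ A′∈L)

  -- Over a nonempty trace, a d-simplex of L B together with T is a (d+1)-simplex of F.
  L-simplexFree-nonempty : ∀ d → T ∈ F → SimplexFree (suc d) F → ∀ B → Nonempty B → SimplexFree d (L B)
  L-simplexFree-nonempty d T∈F free B B-nonempty A′ A′∈L simplex =
    free (T Vector.∷ S) T∷S∈F (simplex-lift-with d T S B trace≡B B-nonempty (IsSimplex-cong d A′≡ simplex))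
    where
    open Preimages (preimages B A′ A′∈L)
    T∷S∈F : ∀ i → (T Vector.∷ S) i ∈ F
    T∷S∈F zero    = T∈F
    T∷S∈F (suc i) = S∈F i

decomposition-bound : ∀ {n} d k (F : Family n) (T : Subset n) (h : ℕ → ℕ) →
  Unique F → SimplexFree (suc d) F → AtMost k F → T ∈ F → ∣ T ∣ + k ≡ n →
  (∀ (L : Family ∣ T ∣) → Unique L → SimplexFree (suc d) L → length L ≤ h 0) →
  (∀ i (L : Family ∣ T ∣) → suc i ≤ k → Unique L → SimplexFree d L → AtMost (suc i) L →
     length L ≤ h (suc i)) →
  length F ≤ binomialSum k h
decomposition-bound {n} d k F T h F! free small T∈F |T|+k≡n bound₀ boundₛ = begin
    length F                                                ≡⟨ length≡sumFibres F ⟩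
    sumSubsets (∣ ∁ T ∣) (λ B → length (fibre B F))         ≤⟨ sumSubsets≤binomialSum _ _ h fibre-bound ⟩
    binomialSum (∣ ∁ T ∣) h                                 ≡⟨ cong (λ c → binomialSum c h) ∣∁T∣≡k ⟩
    binomialSum k h                                         ∎
  where
  open ≤-Reasoning
  open Fibres (restrict (∁ T)) using (fibre; length≡sumFibres)
  open TraceFibres T F

  ∣∁T∣≡k : ∣ ∁ T ∣ ≡ k
  ∣∁T∣≡k = trans (∣∁p∣≡n∸∣p∣ T) (trans (cong (_∸ ∣ T ∣) (sym |T|+k≡n)) (m+n∸m≡n ∣ T ∣ k))

  L-bound : ∀ B i → ∣ B ∣ ≡ i → length (L B) ≤ h i
  L-bound B zero    ∣B∣≡0 = bound₀ (L B) (L-unique F! B)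
    (L-simplexFree-empty (suc d) free B (∣p∣≡0⇒Empty B ∣B∣≡0))
  L-bound B (suc i) ∣B∣≡suc = boundₛ i (L B)
    (subst (_≤ k) ∣B∣≡suc (subst (∣ B ∣ ≤_) ∣∁T∣≡k (∣p∣≤n B)))
    (L-unique F! B)
    (L-simplexFree-nonempty d T∈F free B (∣p∣≡suc⇒Nonempty B ∣B∣≡suc))
    (subst (λ c → AtMost c (L B)) ∣B∣≡suc (L-atMost k small |T|+k≡n B))

  fibre-bound : ∀ B → length (fibre B F) ≤ h ∣ B ∣
  fibre-bound B = subst (_≤ h ∣ B ∣) (length-map (restrict T) (fibre B F)) (L-bound B ∣ B ∣ refl)

binomialSum-split : ∀ k f₀ (fᵢ : ℕ → ℕ) (h : ℕ → ℕ) → h 0 ≡ f₀ → (∀ i → h (suc i) ≡ fᵢ (suc i)) →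
  binomialSum k h ≡ f₀ + sum1to k (λ i → (k C i) * fᵢ i)
binomialSum-split k f₀ fᵢ h h0≡ hₛ≡ = cong₂ _+_
  (trans (*-identityˡ (h 0)) h0≡)
  (trans (sumBelow-cong k (λ i → cong ((k C suc i) *_) (hₛ≡ i)))
         (sym (sum-applyUpTo (λ i → (k C suc i) * fᵢ (suc i)) (λ i → i) k)))

-- Lemma 5: g(n,d,k) ≤ f(n-k,d) + Σ_{i=1}^{k} C(k,i)·f(n-k,d-1,i).
lemma5 : (n d k : ℕ) → 1 ≤ k → k ≤ n → 2 ≤ d →
    (f₀ : ℕ) → IsF (n ∸ k) d f₀ →
    (fᵢ : ℕ → ℕ) → (∀ i → 1 ≤ i → i ≤ k → IsFk (n ∸ k) (d ∸ 1) i (fᵢ i)) →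
    (g : ℕ) → IsG n d k g →
    g ≤ f₀ + sum1to k (λ i → (k C i) * fᵢ i)
lemma5 n (suc d) k _ _ (s≤s _) f₀ isF fᵢ isFᵢ g ((F , F! , (free , small , hasTop) , |F|≡g) , _)
  with find hasTop
... | T , T∈F , |T|+k≡n = begin
    g                                          ≡⟨ |F|≡g ⟨
    length F                                   ≤⟨ decomposition-bound d k F T h F! free small T∈F |T|+k≡n bound₀ boundₛ ⟩
    binomialSum k h                            ≡⟨ binomialSum-split k f₀ fᵢ h refl (λ _ → refl) ⟩
    f₀ + sum1to k (λ i → (k C i) * fᵢ i)       ∎
  where
  open ≤-Reasoning
  |T|≡n∸k : ∣ T ∣ ≡ n ∸ k
  |T|≡n∸k = trans (sym (m+n∸n≡m ∣ T ∣ k)) (cong (_∸ k) |T|+k≡n)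
  h : ℕ → ℕ
  h zero    = f₀
  h (suc i) = fᵢ (suc i)
  bound₀ : ∀ (L : Family ∣ T ∣) → Unique L → SimplexFree (suc d) L → length L ≤ h 0
  bound₀ = proj₂ (subst (λ m → IsF m (suc d) f₀) (sym |T|≡n∸k) isF)
  boundₛ : ∀ i (L : Family ∣ T ∣) → suc i ≤ k → Unique L → SimplexFree d L → AtMost (suc i) L →
    length L ≤ h (suc i)
  boundₛ i L i<k L! Lfree Lsmall =
    proj₂ (subst (λ m → IsFk m d (suc i) (fᵢ (suc i))) (sym |T|≡n∸k) (isFᵢ (suc i) (s≤s z≤n) i<k))
      L L! (Lfree , Lsmall)
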